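{- Let $s\ge 3$ be an integer. Every pseudo-split graph that is a minimal $(s,\infty)$-polar obstruction has at most $2s+4$ vertices, and this bound is tight. Consequently, there are finitely many pseudo-split minimal $(s,\infty)$-polar obstructions.
   Context: All graphs are finite and simple. A graph $G$ is pseudo-split if $V_G$ has a partition $(C,S,I)$ with $C$ a clique, $I$ independent, $S=\varnothing$ or $G[S]\cong C_5$, $C$ completely adjacent to $S$, and no edges between $I$ and $S$. $G$ is $(s,\infty)$-polar if $V_G$ has a partition $(A,B)$ with $G[A]$ a complete multipartite graph with at most $s$ parts and $G[B]$ a disjoint union of complete graphs. A minimal $(s,\infty)$-polar obstruction is a graph that is not $(s,\infty)$-polar but every vertex-deleted subgraph of which is. -}

module Defs where

open import Data.Nat using (ℕ; zero; suc)
open import Data.Fin using (Fin; zero; suc; punchIn)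
open import Data.Bool using (Bool; true; false)
open import Data.Product using (Σ; ∃; _×_; _,_)
open import Data.Sum using (_⊎_)
open import Data.Unit using (⊤)
open import Relation.Binary.PropositionalEquality using (_≡_; _≢_)
open import Relation.Nullary using (¬_)
open import Function.Bundles using (_⇔_)

record Graph (n : ℕ) : Set where
  field
    adj    : Fin n → Fin n → Bool
    sym    : ∀ u v → adj u v ≡ adj v u
    irrefl : ∀ v → adj v v ≡ false
open Graph public

c5 : Fin 5 → Fin 5 → Bool
c5 zero (suc zero) = true
c5 (suc zero) zero = true
c5 (suc zero) (suc (suc zero)) = true
c5 (suc (suc zero)) (suc zero) = true
c5 (suc (suc zero)) (suc (suc (suc zero))) = true
c5 (suc (suc (suc zero))) (suc (suc zero)) = true
c5 (suc (suc (suc zero))) (suc (suc (suc (suc zero)))) = true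
c5 (suc (suc (suc (suc zero)))) (suc (suc (suc zero))) = true
c5 (suc (suc (suc (suc zero)))) zero = true
c5 zero (suc (suc (suc (suc zero)))) = true
c5 _ _ = false

data Block : Set where
  C S I : Block

InducesC5 : ∀ {n} → Graph n → (Fin n → Block) → Set
InducesC5 {n} G part =
  Σ (Fin 5 → Fin n) λ f →
      (∀ i j → f i ≡ f j → i ≡ j)
    × (∀ i → part (f i) ≡ S)
    × (∀ v → part v ≡ S → ∃ λ i → f i ≡ v)
    × (∀ i j → adj G (f i) (f j) ≡ c5 i j)

PseudoSplit : ∀ {n} → Graph n → Set
PseudoSplit {n} G =
  Σ (Fin n → Block) λ part →
      (∀ u v → part u ≡ C → part v ≡ C → u ≢ v → adj G u v ≡ true)
    × (∀ u v → part u ≡ I → part v ≡ I → adj G u v ≡ false)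
    × ((∀ v → ¬ (part v ≡ S)) ⊎ InducesC5 G part)
    × (∀ u v → part u ≡ C → part v ≡ S → adj G u v ≡ true)
    × (∀ u v → part u ≡ I → part v ≡ S → adj G u v ≡ false)

-- G is (s,∞)-polar: a partition (A,B) (inA v ≡ true means v ∈ A) such that
-- G[A] is complete multipartite with at most s parts (p labels the parts:
-- distinct vertices of A are adjacent iff they lie in different parts), and
-- G[B] is a disjoint union of complete graphs (q labels the components:
-- distinct vertices of B are adjacent iff they lie in the same component).
Polar : ℕ → ∀ {n} → Graph n → Set
Polar s {n} G =
  Σ (Fin n → Bool) λ inA →
  Σ (Fin n → Fin s) λ p →
  Σ (Fin n → Fin n) λ q →
      (∀ u v → inA u ≡ true → inA v ≡ true → u ≢ v →
         (adj G u v ≡ true) ⇔ (p u ≢ p v))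
    × (∀ u v → inA u ≡ false → inA v ≡ false → u ≢ v →
         (adj G u v ≡ true) ⇔ (q u ≡ q v))

delete : ∀ {n} → Graph (suc n) → Fin (suc n) → Graph n
delete G v = record
  { adj    = λ i j → adj G (punchIn v i) (punchIn v j)
  ; sym    = λ i j → sym G (punchIn v i) (punchIn v j)
  ; irrefl = λ i → irrefl G (punchIn v i)
  }

MinObstruction : ℕ → ∀ {n} → Graph n → Set
MinObstruction s {zero}  G = ¬ Polar s G × ⊤
MinObstruction s {suc n} G = ¬ Polar s G × (∀ v → Polar s (delete G v))

module Submission where

-- Let G be pseudo-split with S ≅ C₅ and let s = 2 + k. In a polar partition (A, B) the 5-cycle can
-- neither lie in A nor in B. If A contains an edge of the cycle, then every vertex of C with a neighbour
-- in I lies in A and avoids the two parts of that edge; otherwise A contains a cycle vertex and its two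
-- (non-adjacent) cycle neighbours lie in B, which pushes all of C into A, avoiding one part. Conversely
-- such colourings of C extend to polar partitions, so G is (s,∞)-polar iff |C| ≤ s - 1 or
-- |C ∩ N(I)| ≤ s - 2. In a minimal obstruction, deleting a suitable vertex of C yields |C| ≤ s.
-- Deleting x₀ ∈ I yields |C ∩ N(I)| ≤ s - 2 in G - x₀, and minimality gives every x ∈ I a private
-- neighbour in C, so |I| ≤ s - 1; with |S| = 5 this is 2s + 4. Equality holds when |C| = s, |I| = s - 1
-- and I is matched into C. If S = ∅ the graph is split, hence polar.

open import Defs hiding (sym)
open import Data.Nat using (ℕ; _≤_; _+_; _*_)
open import Data.Product using (Σ; _×_)

import Data.Bool as Bool
open import Data.Bool using (Bool; true; false; not)
open import Data.Bool.Properties using (¬-not)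
open import Data.Empty using (⊥; ⊥-elim)
open import Data.Fin using (Fin; zero; punchIn; punchOut; inject₁; _↑ˡ_; _↑ʳ_; splitAt)
open import Data.Fin.Patterns using (0F; 1F; 2F; 3F; 4F)
import Data.Fin.Properties as Fin
import Data.Nat as ℕ
import Data.Nat.Properties as ℕₚ
open import Data.Nat.Tactic.RingSolver using (solve-∀)
open import Data.Product using (∃; ∃-syntax; _,_; proj₁; proj₂)
import Data.Sum as Sum
open import Data.Sum using (_⊎_; inj₁; inj₂; [_,_]′)
import Data.Unit as Unit
open import Data.Unit using (⊤; tt)
open import Function.Base using (_∘_; _$_; const; id; case_of_)
open import Function.Bundles using (_⇔_; mk⇔; Equivalence)
open import Function.Definitions using (Injective)
open import Relation.Binary.Definitions using (DecidableEquality)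
open import Relation.Binary.PropositionalEquality
open import Relation.Nullary using (¬_; Dec; yes; no; does; _×-dec_; _→-dec_; ¬?)
open import Relation.Nullary.Decidable using (toWitness; decidable-stable; map′; dec-true; dec-false; does-⇔)

private
  variable
    k m n : ℕ
    X Y : Fin n → Set

c5-sym : ∀ i j → c5 i j ≡ c5 j i
c5-sym = toWitness {a? = Fin.all? λ i → Fin.all? λ j → c5 i j Bool.≟ c5 j i} tt

c5-irrefl : ∀ i → c5 i i ≡ false
c5-irrefl = toWitness {a? = Fin.all? λ i → c5 i i Bool.≟ false} tt

c5-edge⇒≢ : ∀ {i j} → c5 i j ≡ true → i ≢ j
c5-edge⇒≢ {i} edge refl = case trans (sym edge) (c5-irrefl i) of λ ()

c5-two-neighbours : ∀ z → ∃[ i ] ∃[ j ] c5 z i ≡ true × c5 z j ≡ true × i ≢ j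
c5-two-neighbours = toWitness {a? = Fin.all? λ z → Fin.any? λ i → Fin.any? λ j →
  (c5 z i Bool.≟ true) ×-dec (c5 z j Bool.≟ true) ×-dec ¬? (i Fin.≟ j)} tt

c5-common-neighbours-nonadjacent : ∀ a b c → c5 a b ≡ true → c5 a c ≡ true → b ≢ c → c5 b c ≡ false
c5-common-neighbours-nonadjacent = toWitness {a? = Fin.all? λ a → Fin.all? λ b → Fin.all? λ c →
  (c5 a b Bool.≟ true) →-dec (c5 a c Bool.≟ true) →-dec ¬? (b Fin.≟ c) →-dec (c5 b c Bool.≟ false)} tt

c5-common-non-neighbours-adjacent : ∀ a b c → a ≢ b → a ≢ c → c5 a b ≡ false → c5 a c ≡ false → b ≢ c →
                                    c5 b c ≡ true
c5-common-non-neighbours-adjacent = toWitness {a? = Fin.all? λ a → Fin.all? λ b → Fin.all? λ c →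
  ¬? (a Fin.≟ b) →-dec ¬? (a Fin.≟ c) →-dec (c5 a b Bool.≟ false) →-dec (c5 a c Bool.≟ false) →-dec
  ¬? (b Fin.≟ c) →-dec (c5 b c Bool.≟ true)} tt

record AtMost {n : ℕ} (k : ℕ) (X : Fin n → Set) : Set where
  field
    index           : ∀ v → X v → Fin k
    index-injective : ∀ u w xu xw → index u xu ≡ index w xw → u ≡ w
open AtMost

AtMost-empty : (∀ v → ¬ X v) → AtMost k X
AtMost-empty none = record
  { index           = λ v xv → ⊥-elim (none v xv)
  ; index-injective = λ u _ xu _ _ → ⊥-elim (none u xu)
  }

AtMost-suc : AtMost k X → AtMost (1 + k) X
AtMost-suc X≤k = record
  { index           = λ v xv → inject₁ (index X≤k v xv)
  ; index-injective = λ u w xu xw → index-injective X≤k u w xu xw ∘ Fin.inject₁-injective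
  }

AtMost-inject : ∀ {n′} {X : Fin n → Set} {Y : Fin n′ → Set} (g : ∀ v → X v → Fin n′) →
                (∀ v xv → Y (g v xv)) → (∀ u w xu xw → g u xu ≡ g w xw → u ≡ w) → AtMost k Y → AtMost k X
AtMost-inject g g-into g-injective Y≤k = record
  { index           = λ v xv → index Y≤k (g v xv) (g-into v xv)
  ; index-injective = λ u w xu xw → g-injective u w xu xw ∘ index-injective Y≤k _ _ _ _
  }

AtMost-⊆ : (∀ v → X v → Y v) → AtMost k Y → AtMost k X
AtMost-⊆ X⊆Y = AtMost-inject (λ v _ → v) X⊆Y (λ _ _ _ _ → id)

AtMost⇒≤ : AtMost k (λ (_ : Fin n) → ⊤) → n ≤ k
AtMost⇒≤ V≤k = Fin.injective⇒≤ (index-injective V≤k _ _ tt tt)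

AtMost-pigeonhole : (e : Fin m → Fin n) → (∀ i j → e i ≡ e j → i ≡ j) → (∀ i → X (e i)) → AtMost k X → m ≤ k
AtMost-pigeonhole e e-injective e-into =
  AtMost⇒≤ ∘ AtMost-inject (λ i _ → e i) (λ i _ → e-into i) (λ i j _ _ → e-injective i j)

↑ˡ≢↑ʳ : ∀ (i : Fin m) (j : Fin n) → i ↑ˡ n ≢ m ↑ʳ j
↑ˡ≢↑ʳ {m} {n} i j eq
  with trans (sym (Fin.splitAt-↑ˡ m i n)) (trans (cong (splitAt m) eq) (Fin.splitAt-↑ʳ m n j))
... | ()

AtMost-⊎ : ∀ {a b} → AtMost a X → AtMost b Y → AtMost (a + b) (λ v → X v ⊎ Y v)
AtMost-⊎ {X = X} {Y = Y} {a = a} {b} X≤a Y≤b = record { index = index⊎ ; index-injective = injective }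
  where
  index⊎ : ∀ v → X v ⊎ Y v → Fin (a + b)
  index⊎ v (inj₁ xv) = index X≤a v xv ↑ˡ b
  index⊎ v (inj₂ yv) = a ↑ʳ index Y≤b v yv
  injective : ∀ u w zu zw → index⊎ u zu ≡ index⊎ w zw → u ≡ w
  injective u w (inj₁ xu) (inj₁ xw) = index-injective X≤a u w xu xw ∘ Fin.↑ˡ-injective b _ _
  injective u w (inj₂ yu) (inj₂ yw) = index-injective Y≤b u w yu yw ∘ Fin.↑ʳ-injective a _ _
  injective u w (inj₁ xu) (inj₂ yw) = ⊥-elim ∘ ↑ˡ≢↑ʳ _ _
  injective u w (inj₂ yu) (inj₁ xw) = ⊥-elim ∘ ↑ˡ≢↑ʳ _ _ ∘ sym

AtMost-singleton : (v : Fin n) → AtMost 1 (_≡ v)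
AtMost-singleton v = record { index = λ _ _ → zero ; index-injective = λ { u w refl refl _ → refl } }

AtMost-insert : (v : Fin n) → AtMost k (λ u → X u × v ≢ u) → AtMost (1 + k) X
AtMost-insert {X = X} v X-v≤k = AtMost-⊆ split (AtMost-⊎ (AtMost-singleton v) X-v≤k)
  where
  split : ∀ u → X u → u ≡ v ⊎ (X u × v ≢ u)
  split u xu with v Fin.≟ u
  ... | yes v≡u = inj₁ (sym v≡u)
  ... | no  v≢u = inj₂ (xu , v≢u)

AtMost-remove : ∀ {v} → AtMost (1 + k) X → X v → AtMost k (λ u → X u × v ≢ u)
AtMost-remove {X = X} {v = v} X≤ xv = record
  { index           = λ u (xu , v≢u) → punchOut (index-differs u xu v≢u)
  ; index-injective = λ u w (xu , v≢u) (xw , v≢w) →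
      index-injective X≤ u w xu xw ∘ Fin.punchOut-injective (index-differs u xu v≢u) (index-differs w xw v≢w)
  }
  where
  index-differs : ∀ u xu → v ≢ u → index X≤ v xv ≢ index X≤ u xu
  index-differs u xu v≢u = v≢u ∘ index-injective X≤ v u xv xu

AtMost-unpunch : ∀ {X : Fin (1 + n) → Set} (v : Fin (1 + n)) →
                 AtMost k (X ∘ punchIn v) → AtMost k (λ u → X u × v ≢ u)
AtMost-unpunch {X = X} v =
  AtMost-inject (λ u (_ , v≢u) → punchOut v≢u)
                (λ u (xu , v≢u) → subst X (sym (Fin.punchIn-punchOut v≢u)) xu)
                (λ u w (_ , v≢u) (_ , v≢w) → Fin.punchOut-injective v≢u v≢w)

AtMost-avoiding : (f : ∀ v → X v → Fin (1 + k)) (t : Fin (1 + k)) → (∀ v xv → t ≢ f v xv) →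
                  (∀ u w xu xw → f u xu ≡ f w xw → u ≡ w) → AtMost k X
AtMost-avoiding f t avoids f-injective = record
  { index           = λ v xv → punchOut (avoids v xv)
  ; index-injective = λ u w xu xw → f-injective u w xu xw ∘ Fin.punchOut-injective (avoids u xu) (avoids w xw)
  }

AtMost-avoiding₂ : (f : ∀ v → X v → Fin (2 + k)) {t₁ t₂ : Fin (2 + k)} → t₁ ≢ t₂ →
                   (∀ v xv → t₁ ≢ f v xv) → (∀ v xv → t₂ ≢ f v xv) →
                   (∀ u w xu xw → f u xu ≡ f w xw → u ≡ w) → AtMost k X
AtMost-avoiding₂ f t₁≢t₂ avoids₁ avoids₂ f-injective =
  AtMost-avoiding (λ v xv → punchOut (avoids₁ v xv)) (punchOut t₁≢t₂)
    (λ v xv → avoids₂ v xv ∘ Fin.punchOut-injective t₁≢t₂ (avoids₁ v xv))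
    (λ u w xu xw → f-injective u w xu xw ∘ Fin.punchOut-injective (avoids₁ u xu) (avoids₁ w xw))

module PolarPartition {s n : ℕ} {G : Graph n} (Q : Polar s G) where

  inA : Fin n → Bool
  inA = proj₁ Q

  colour : Fin n → Fin s
  colour = proj₁ (proj₂ Q)

  private
    component : Fin n → Fin n
    component = proj₁ (proj₂ (proj₂ Q))

    multipartite : ∀ u w → inA u ≡ true → inA w ≡ true → u ≢ w → (adj G u w ≡ true) ⇔ (colour u ≢ colour w)
    multipartite = proj₁ (proj₂ (proj₂ (proj₂ Q)))

    cliques : ∀ u w → inA u ≡ false → inA w ≡ false → u ≢ w → (adj G u w ≡ true) ⇔ (component u ≡ component w)
    cliques = proj₂ (proj₂ (proj₂ (proj₂ Q)))

  A-edge⇒colours-differ : ∀ {u w} → inA u ≡ true → inA w ≡ true → u ≢ w → adj G u w ≡ true →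
                          colour u ≢ colour w
  A-edge⇒colours-differ au aw u≢w = Equivalence.to (multipartite _ _ au aw u≢w)

  A-non-edge⇒same-colour : ∀ {u w} → inA u ≡ true → inA w ≡ true → u ≢ w → adj G u w ≡ false →
                           colour u ≡ colour w
  A-non-edge⇒same-colour {u} {w} au aw u≢w uw with colour u Fin.≟ colour w
  ... | yes same = same
  ... | no  differ = case trans (sym (Equivalence.from (multipartite _ _ au aw u≢w) differ)) uw of λ ()

  A-non-edge-trans : ∀ {u w z} → inA u ≡ true → inA w ≡ true → inA z ≡ true → u ≢ w → w ≢ z → u ≢ z →
                     adj G u w ≡ false → adj G w z ≡ false → adj G u z ≡ false
  A-non-edge-trans au aw az u≢w w≢z u≢z uw wz = ¬-not λ uz →
    A-edge⇒colours-differ au az u≢z uz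
      (trans (A-non-edge⇒same-colour au aw u≢w uw) (A-non-edge⇒same-colour aw az w≢z wz))

  B-edge-trans : ∀ {u w z} → inA u ≡ false → inA w ≡ false → inA z ≡ false → u ≢ w → w ≢ z → u ≢ z →
                 adj G u w ≡ true → adj G w z ≡ true → adj G u z ≡ true
  B-edge-trans bu bw bz u≢w w≢z u≢z uw wz =
    Equivalence.from (cliques _ _ bu bz u≢z)
      (trans (Equivalence.to (cliques _ _ bu bw u≢w) uw) (Equivalence.to (cliques _ _ bw bz w≢z) wz))

-- A role inj₁ a puts a vertex into part a of A, a role inj₂ b into component b of B.
Compatible : {A B : Set} → Bool → A ⊎ B → A ⊎ B → Set
Compatible e (inj₁ a) (inj₁ b) = (e ≡ true) ⇔ (a ≢ b)
Compatible e (inj₂ a) (inj₂ b) = (e ≡ true) ⇔ (a ≡ b)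
Compatible e _        _        = ⊤

_⇔?_ : {P R : Set} → Dec P → Dec R → Dec (P ⇔ R)
p? ⇔? r? = map′ (λ (f , g) → mk⇔ f g) (λ p⇔r → Equivalence.to p⇔r , Equivalence.from p⇔r)
                ((p? →-dec r?) ×-dec (r? →-dec p?))

module _ {A B : Set} where

  compatible? : DecidableEquality A → DecidableEquality B → ∀ e (r r′ : A ⊎ B) → Dec (Compatible e r r′)
  compatible? _≟A_ _    e (inj₁ a) (inj₁ b) = (e Bool.≟ true) ⇔? ¬? (a ≟A b)
  compatible? _    _≟B_ e (inj₂ a) (inj₂ b) = (e Bool.≟ true) ⇔? (a ≟B b)
  compatible? _    _    e (inj₁ _) (inj₂ _) = yes tt
  compatible? _    _    e (inj₂ _) (inj₁ _) = yes tt

  Compatible-sym : ∀ {e} (r r′ : A ⊎ B) → Compatible e r r′ → Compatible e r′ r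
  Compatible-sym (inj₁ _) (inj₁ _) c =
    mk⇔ (λ h → Equivalence.to c h ∘ sym) (λ b≢a → Equivalence.from c (b≢a ∘ sym))
  Compatible-sym (inj₂ _) (inj₂ _) c = mk⇔ (sym ∘ Equivalence.to c) (Equivalence.from c ∘ sym)
  Compatible-sym (inj₁ _) (inj₂ _) _ = tt
  Compatible-sym (inj₂ _) (inj₁ _) _ = tt

  Compatible-swap : (G : Graph n) {u w : Fin n} (r r′ : A ⊎ B) →
                    Compatible (adj G w u) r′ r → Compatible (adj G u w) r r′
  Compatible-swap G {u} {w} r r′ c = subst (λ e → Compatible e r r′) (Graph.sym G w u) (Compatible-sym r′ r c)

  compatible-A-edge : ∀ {a b : A} → a ≢ b → Compatible {A} {B} true (inj₁ a) (inj₁ b)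
  compatible-A-edge a≢b = mk⇔ (const a≢b) (const refl)

  compatible-A-non-edge : ∀ {a : A} → Compatible {A} {B} false (inj₁ a) (inj₁ a)
  compatible-A-non-edge = mk⇔ (λ ()) (λ a≢a → ⊥-elim (a≢a refl))

  compatible-B-edge : ∀ {b : B} → Compatible {A} {B} true (inj₂ b) (inj₂ b)
  compatible-B-edge = mk⇔ (const refl) (const refl)

  compatible-B-non-edge : ∀ {a b : B} → a ≢ b → Compatible {A} {B} false (inj₂ a) (inj₂ b)
  compatible-B-non-edge a≢b = mk⇔ (λ ()) (⊥-elim ∘ a≢b)

Compatible-map : ∀ {A B A′ B′ : Set} {f : A → A′} {g : B → B′} → Injective _≡_ _≡_ f → Injective _≡_ _≡_ g →
                 ∀ {e} r r′ → Compatible e r r′ → Compatible e (Sum.map f g r) (Sum.map f g r′)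
Compatible-map {f = f} f-injective _ (inj₁ _) (inj₁ _) c =
  mk⇔ (λ h → Equivalence.to c h ∘ f-injective) (λ fa≢fb → Equivalence.from c (fa≢fb ∘ cong f))
Compatible-map {g = g} _ g-injective (inj₂ _) (inj₂ _) c =
  mk⇔ (cong g ∘ Equivalence.to c) (Equivalence.from c ∘ g-injective)
Compatible-map _ _ (inj₁ _) (inj₂ _) _ = tt
Compatible-map _ _ (inj₂ _) (inj₁ _) _ = tt

roles⇒polar : ∀ {s} (G : Graph n) (role : Fin n → Fin (1 + s) ⊎ Fin n) →
              (∀ u w → u ≢ w → Compatible (adj G u w) (role u) (role w)) → Polar (1 + s) G
roles⇒polar {n} {s} G role compatible = inA , colour , component , multipartite , cliques
  where
  inA : Fin n → Bool
  inA v = [ const true , const false ]′ (role v)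
  colour : Fin n → Fin (1 + s)
  colour v = [ id , const zero ]′ (role v)
  component : Fin n → Fin n
  component v = [ const v , id ]′ (role v)
  multipartite : ∀ u w → inA u ≡ true → inA w ≡ true → u ≢ w → (adj G u w ≡ true) ⇔ (colour u ≢ colour w)
  multipartite u w au aw u≢w with role u | role w | compatible u w u≢w
  ... | inj₁ _ | inj₁ _ | c = c
  multipartite u w () aw u≢w | inj₂ _ | _ | _
  multipartite u w au () u≢w | inj₁ _ | inj₂ _ | _
  cliques : ∀ u w → inA u ≡ false → inA w ≡ false → u ≢ w → (adj G u w ≡ true) ⇔ (component u ≡ component w)
  cliques u w bu bw u≢w with role u | role w | compatible u w u≢w
  ... | inj₂ _ | inj₂ _ | c = c
  cliques u w () bw u≢w | inj₁ _ | _ | _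
  cliques u w bu () u≢w | inj₂ _ | inj₁ _ | _

collapse : Fin n → Fin n
collapse {ℕ.suc n} _ = zero

collapse-const : (u w : Fin n) → collapse u ≡ collapse w
collapse-const {ℕ.suc n} _ _ = refl

split⇒polar : ∀ {s} (G : Graph n) (inA : Fin n → Bool) →
              (∀ u w → inA u ≡ true → inA w ≡ true → u ≢ w → adj G u w ≡ false) →
              (∀ u w → inA u ≡ false → inA w ≡ false → u ≢ w → adj G u w ≡ true) → Polar (1 + s) G
split⇒polar {n} {s} G inA independent clique = roles⇒polar G role compatible
  where
  role : Fin n → Fin (1 + s) ⊎ Fin n
  role v = Bool.if inA v then inj₁ zero else inj₂ (collapse v)
  compatible : ∀ u w → u ≢ w → Compatible (adj G u w) (role u) (role w)
  compatible u w u≢w with inA u in au | inA w in aw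
  ... | true  | true  rewrite independent u w au aw u≢w = compatible-A-non-edge {B = Fin n}
  ... | false | false rewrite clique u w au aw u≢w = mk⇔ (const (collapse-const u w)) (const refl)
  ... | true  | false = tt
  ... | false | true  = tt

_≟ᴮ_ : DecidableEquality Block
C ≟ᴮ C = yes refl
S ≟ᴮ S = yes refl
I ≟ᴮ I = yes refl
C ≟ᴮ S = no λ ()
C ≟ᴮ I = no λ ()
S ≟ᴮ C = no λ ()
S ≟ᴮ I = no λ ()
I ≟ᴮ C = no λ ()
I ≟ᴮ S = no λ ()

record PseudoSplitC5 {n : ℕ} (G : Graph n) : Set where
  field
    block               : Fin n → Block
    cycle               : Fin 5 → Fin n
    cycle-injective     : ∀ i j → cycle i ≡ cycle j → i ≡ j
    cycle-in-S          : ∀ i → block (cycle i) ≡ S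
    cycle-onto-S        : ∀ v → block v ≡ S → ∃ λ i → cycle i ≡ v
    cycle-adj           : ∀ i j → adj G (cycle i) (cycle j) ≡ c5 i j
    C-clique            : ∀ u v → block u ≡ C → block v ≡ C → u ≢ v → adj G u v ≡ true
    I-independent       : ∀ u v → block u ≡ I → block v ≡ I → adj G u v ≡ false
    C-complete-to-S     : ∀ u v → block u ≡ C → block v ≡ S → adj G u v ≡ true
    I-anticomplete-to-S : ∀ u v → block u ≡ I → block v ≡ S → adj G u v ≡ false

  Is : Block → Fin n → Set
  Is b v = block v ≡ b

  HasINeighbour : Fin n → Set
  HasINeighbour v = ∃ λ x → block x ≡ I × adj G v x ≡ true

  IsCI : Fin n → Set
  IsCI v = block v ≡ C × HasINeighbour v

  INeighbourOtherThan : Fin n → Fin n → Set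
  INeighbourOtherThan v c = ∃ λ x → block x ≡ I × v ≢ x × adj G c x ≡ true

  CliqueBound : ℕ → Set
  CliqueBound k = AtMost (1 + k) (Is C) ⊎ AtMost k IsCI

  hasINeighbour? : ∀ v → Dec (HasINeighbour v)
  hasINeighbour? v = Fin.any? λ x → (block x ≟ᴮ I) ×-dec (adj G v x Bool.≟ true)

  iNeighbourOtherThan? : ∀ v c → Dec (INeighbourOtherThan v c)
  iNeighbourOtherThan? v c = Fin.any? λ x → (block x ≟ᴮ I) ×-dec ¬? (v Fin.≟ x) ×-dec (adj G c x Bool.≟ true)

  other-block : ∀ {v b b′} → block v ≡ b → b ≢ b′ → block v ≢ b′
  other-block vb b≢b′ vb′ = b≢b′ (trans (sym vb) vb′)

  blocks-differ : ∀ {u w b b′} → block u ≡ b → block w ≡ b′ → b ≢ b′ → u ≢ w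
  blocks-differ ub wb′ b≢b′ refl = other-block ub b≢b′ wb′

  cycle-≢ : ∀ {i j} → i ≢ j → cycle i ≢ cycle j
  cycle-≢ i≢j = i≢j ∘ cycle-injective _ _

  position : ∀ v → block v ≡ S → Fin 5
  position v vS = proj₁ (cycle-onto-S v vS)

  cycle-position : ∀ v vS → cycle (position v vS) ≡ v
  cycle-position v vS = proj₂ (cycle-onto-S v vS)

  position-injective : ∀ u w uS wS → position u uS ≡ position w wS → u ≡ w
  position-injective u w uS wS eq = trans (sym (cycle-position u uS)) (trans (cong cycle eq) (cycle-position w wS))

  position-≢ : ∀ {u w} uS wS → u ≢ w → position u uS ≢ position w wS
  position-≢ uS wS u≢w = u≢w ∘ position-injective _ _ uS wS

  adj-S : ∀ {u w} uS wS → adj G u w ≡ c5 (position u uS) (position w wS)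
  adj-S {u} {w} uS wS = trans (sym (cong₂ (adj G) (cycle-position u uS) (cycle-position w wS))) (cycle-adj _ _)

  S-bound : AtMost 5 (Is S)
  S-bound = record { index = position ; index-injective = position-injective }

module _ {G : Graph n} where

  PseudoSplit⇒polar⊎C5 : ∀ {s} → PseudoSplit G → Polar (1 + s) G ⊎ PseudoSplitC5 G
  PseudoSplit⇒polar⊎C5 (block , C-clique , I-independent , inj₁ no-S , _) =
    inj₁ (split⇒polar G (is-I ∘ block) (λ u w uI wI _ → I-independent u w (is-I-true uI) (is-I-true wI))
                                       (λ u w uC wC → C-clique u w (is-I-false uC (no-S u)) (is-I-false wC (no-S w))))
    where
    is-I : Block → Bool
    is-I I = true
    is-I _ = false
    is-I-true : ∀ {b} → is-I b ≡ true → b ≡ I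
    is-I-true {I} _ = refl
    is-I-false : ∀ {b} → is-I b ≡ false → b ≢ S → b ≡ C
    is-I-false {C} _ _   = refl
    is-I-false {S} _ b≢S = ⊥-elim (b≢S refl)
  PseudoSplit⇒polar⊎C5 (block , C-clique , I-independent ,
                        inj₂ (cycle , cycle-injective , cycle-in-S , cycle-onto-S , cycle-adj) , CS , IS) =
    inj₂ record
      { block = block ; cycle = cycle ; cycle-injective = cycle-injective ; cycle-in-S = cycle-in-S
      ; cycle-onto-S = cycle-onto-S ; cycle-adj = cycle-adj ; C-clique = C-clique ; I-independent = I-independent
      ; C-complete-to-S = CS ; I-anticomplete-to-S = IS
      }

  PseudoSplitC5⇒PseudoSplit : PseudoSplitC5 G → PseudoSplit G
  PseudoSplitC5⇒PseudoSplit P =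
    block , C-clique , I-independent , inj₂ (cycle , cycle-injective , cycle-in-S , cycle-onto-S , cycle-adj) ,
    C-complete-to-S , I-anticomplete-to-S
    where open PseudoSplitC5 P

module _ {G : Graph n} (P : PseudoSplitC5 G) where
  open PseudoSplitC5 P

  module _ {k : ℕ} (Q : Polar (2 + k) G) where
    open PolarPartition {2 + k} {G = G} Q

    A-cycle B-cycle : Fin 5 → Set
    A-cycle i = inA (cycle i) ≡ true
    B-cycle i = inA (cycle i) ≡ false

    cycle⊄A : ¬ (∀ i → A-cycle i)
    cycle⊄A all-A = case trans (sym non-edge) (cycle-adj 0F 4F) of λ ()
      where
      non-edge : adj G (cycle 0F) (cycle 4F) ≡ false
      non-edge = A-non-edge-trans (all-A 0F) (all-A 2F) (all-A 4F) (cycle-≢ λ ()) (cycle-≢ λ ()) (cycle-≢ λ ())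
                   (cycle-adj 0F 2F) (cycle-adj 2F 4F)

    cycle⊄B : ¬ (∀ i → B-cycle i)
    cycle⊄B all-B = case trans (sym edge) (cycle-adj 0F 2F) of λ ()
      where
      edge : adj G (cycle 0F) (cycle 2F) ≡ true
      edge = B-edge-trans (all-B 0F) (all-B 1F) (all-B 2F) (cycle-≢ λ ()) (cycle-≢ λ ()) (cycle-≢ λ ())
               (cycle-adj 0F 1F) (cycle-adj 1F 2F)

    C⊆A : ∀ {i j} → i ≢ j → c5 i j ≡ false → B-cycle i → B-cycle j → ∀ c → block c ≡ C → inA c ≡ true
    C⊆A {i} {j} i≢j non-edge bi bj c cC = ¬-not λ bc →
      case trans (sym (B-edge-trans bi bc bj (c≢cycle i ∘ sym) (c≢cycle j) (cycle-≢ i≢j)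
                         (trans (Graph.sym G _ _) (C-complete-to-S c _ cC (cycle-in-S i)))
                         (C-complete-to-S c _ cC (cycle-in-S j))))
                 (trans (cycle-adj i j) non-edge) of λ ()
      where
      c≢cycle : ∀ l → c ≢ cycle l
      c≢cycle l = blocks-differ cC (cycle-in-S l) λ ()

    CI⊆A : ∀ {i j w} → c5 i j ≡ true → A-cycle i → A-cycle j → B-cycle w → ∀ c → IsCI c → inA c ≡ true
    CI⊆A {i} {j} {w} edge ai aj bw c (cC , x , xI , cx) = ¬-not λ bc → x-nowhere bc (inA x) refl
      where
      x≢cycle : ∀ l → x ≢ cycle l
      x≢cycle l = blocks-differ xI (cycle-in-S l) λ ()
      x-nowhere : inA c ≡ false → ∀ b → inA x ≡ b → ⊥
      x-nowhere bc true ax =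
        case trans (sym (A-non-edge-trans ai ax aj (x≢cycle i ∘ sym) (x≢cycle j) (cycle-≢ (c5-edge⇒≢ edge))
                          (trans (Graph.sym G _ _) (I-anticomplete-to-S x _ xI (cycle-in-S i)))
                          (I-anticomplete-to-S x _ xI (cycle-in-S j))))
                   (trans (cycle-adj i j) edge) of λ ()
      x-nowhere bc false bx =
        case trans (sym (B-edge-trans bx bc bw (blocks-differ xI cC λ ()) (blocks-differ cC (cycle-in-S w) λ ())
                          (x≢cycle w) (trans (Graph.sym G x c) cx) (C-complete-to-S c _ cC (cycle-in-S w))))
                   (I-anticomplete-to-S x _ xI (cycle-in-S w)) of λ ()

    colour-injective-on-C : ∀ u w → block u ≡ C → block w ≡ C → inA u ≡ true → inA w ≡ true →
                            colour u ≡ colour w → u ≡ w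
    colour-injective-on-C u w uC wC au aw same with u Fin.≟ w
    ... | yes u≡w = u≡w
    ... | no  u≢w = ⊥-elim (A-edge⇒colours-differ au aw u≢w (C-clique u w uC wC u≢w) same)

    colour-differs-from-cycle : ∀ {c} i → block c ≡ C → inA c ≡ true → A-cycle i → colour (cycle i) ≢ colour c
    colour-differs-from-cycle i cC ac ai =
      A-edge⇒colours-differ ai ac (blocks-differ (cycle-in-S i) cC λ ())
        (trans (Graph.sym G _ _) (C-complete-to-S _ _ cC (cycle-in-S i)))

    A-edge⇒CI-bound : ∀ {i j w} → c5 i j ≡ true → A-cycle i → A-cycle j → B-cycle w → AtMost k IsCI
    A-edge⇒CI-bound {i} {j} edge ai aj bw =
      AtMost-avoiding₂ (λ c _ → colour c)
        (A-edge⇒colours-differ ai aj (cycle-≢ (c5-edge⇒≢ edge)) (trans (cycle-adj i j) edge))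
        (λ c cCI → colour-differs-from-cycle i (proj₁ cCI) (A c cCI) ai)
        (λ c cCI → colour-differs-from-cycle j (proj₁ cCI) (A c cCI) aj)
        (λ u w uCI wCI → colour-injective-on-C u w (proj₁ uCI) (proj₁ wCI) (A u uCI) (A w wCI))
      where
      A : ∀ c → IsCI c → inA c ≡ true
      A = CI⊆A edge ai aj bw

    A-vertex⇒clique-bound : ∀ {z} → (∀ i j → ¬ (c5 i j ≡ true × A-cycle i × A-cycle j)) → A-cycle z →
                            AtMost (1 + k) (Is C)
    A-vertex⇒clique-bound {z} no-A-edge az with c5-two-neighbours z
    ... | i , j , zi , zj , i≢j =
      AtMost-avoiding (λ c _ → colour c) (colour (cycle z))
        (λ c cC → colour-differs-from-cycle z cC (A c cC) az)
        (λ u w uC wC → colour-injective-on-C u w uC wC (A u uC) (A w wC))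
      where
      A : ∀ c → block c ≡ C → inA c ≡ true
      A = C⊆A i≢j (c5-common-neighbours-nonadjacent z i j zi zj i≢j)
              (¬-not λ ai → no-A-edge z i (zi , az , ai)) (¬-not λ aj → no-A-edge z j (zj , az , aj))

    polar⇒bounded : CliqueBound k
    polar⇒bounded with Fin.any? (λ i → Fin.any? λ j →
                         (c5 i j Bool.≟ true) ×-dec (inA (cycle i) Bool.≟ true) ×-dec (inA (cycle j) Bool.≟ true))
    ... | yes (i , j , edge , ai , aj) with Fin.any? (λ w → inA (cycle w) Bool.≟ false)
    ...   | yes (w , bw) = inj₂ (A-edge⇒CI-bound edge ai aj bw)
    ...   | no  no-B     = ⊥-elim (cycle⊄A λ i → ¬-not (no-B ∘ (i ,_)))
    polar⇒bounded | no no-A-edge with Fin.any? (λ z → inA (cycle z) Bool.≟ true)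
    ... | yes (z , az) = inj₁ (A-vertex⇒clique-bound (λ i j edge → no-A-edge (i , j , edge)) az)
    ... | no  no-A     = ⊥-elim (cycle⊄B λ i → ¬-not (no-A ∘ (i ,_)))

small-C-cycle-role : Fin 5 → Fin 1 ⊎ Fin 5
small-C-cycle-role 0F = inj₂ 0F
small-C-cycle-role 1F = inj₁ 0F
small-C-cycle-role 2F = inj₂ 2F
small-C-cycle-role 3F = inj₂ 2F
small-C-cycle-role 4F = inj₁ 0F

small-C-cycle-role-compatible : ∀ i j → i ≢ j → Compatible (c5 i j) (small-C-cycle-role i) (small-C-cycle-role j)
small-C-cycle-role-compatible = toWitness {a? = Fin.all? λ i → Fin.all? λ j →
  ¬? (i Fin.≟ j) →-dec compatible? Fin._≟_ Fin._≟_ (c5 i j) (small-C-cycle-role i) (small-C-cycle-role j)} tt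

-- B ∩ S = {2, 3} will share its component with C ∖ N(I).
small-CI-cycle-role : Fin 5 → Fin 2 ⊎ ⊤
small-CI-cycle-role 0F = inj₁ 0F
small-CI-cycle-role 1F = inj₁ 1F
small-CI-cycle-role 2F = inj₂ tt
small-CI-cycle-role 3F = inj₂ tt
small-CI-cycle-role 4F = inj₁ 1F

small-CI-cycle-role-compatible : ∀ i j → i ≢ j → Compatible (c5 i j) (small-CI-cycle-role i) (small-CI-cycle-role j)
small-CI-cycle-role-compatible = toWitness {a? = Fin.all? λ i → Fin.all? λ j →
  ¬? (i Fin.≟ j) →-dec compatible? Fin._≟_ Unit._≟_ (c5 i j) (small-CI-cycle-role i) (small-CI-cycle-role j)} tt

module _ {G : Graph n} (P : PseudoSplitC5 G) {k : ℕ} where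
  open PseudoSplitC5 P

  private
    swap : ∀ (role : ∀ v b → block v ≡ b → Fin (2 + k) ⊎ Fin n) u w bu bw
             (ub : block u ≡ bu) (wb : block w ≡ bw) →
           Compatible (adj G w u) (role w bw wb) (role u bu ub) → Compatible (adj G u w) (role u bu ub) (role w bw wb)
    swap role u w bu bw ub wb = Compatible-swap G (role u bu ub) (role w bw wb)

  clique-bound⇒polar : AtMost (1 + k) (Is C) → Polar (2 + k) G
  clique-bound⇒polar C≤ = roles⇒polar G (λ v → role v (block v) refl) (λ u w → compatible u w _ _ refl refl)
    where
    S-role : Fin 1 ⊎ Fin 5 → Fin (2 + k) ⊎ Fin n
    S-role = Sum.map (_↑ˡ (1 + k)) cycle
    role : ∀ v b → block v ≡ b → Fin (2 + k) ⊎ Fin n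
    role v C vC = inj₁ (1 ↑ʳ index C≤ v vC)
    role v S vS = S-role (small-C-cycle-role (position v vS))
    role v I _  = inj₂ v
    C-vs-S : ∀ {a} r → Compatible true (inj₁ (1 ↑ʳ a)) (S-role r)
    C-vs-S {a} (inj₁ b) = compatible-A-edge {B = Fin n} (↑ˡ≢↑ʳ b a ∘ sym)
    C-vs-S     (inj₂ _) = tt
    S-vs-I : ∀ {x} → block x ≡ I → ∀ r → Compatible false (S-role r) (inj₂ x)
    S-vs-I _  (inj₁ _) = tt
    S-vs-I xI (inj₂ l) = compatible-B-non-edge {A = Fin (2 + k)} (blocks-differ (cycle-in-S l) xI λ ())
    compatible : ∀ u w bu bw (ub : block u ≡ bu) (wb : block w ≡ bw) → u ≢ w →
                 Compatible (adj G u w) (role u bu ub) (role w bw wb)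
    compatible u w C C uC wC u≢w rewrite C-clique u w uC wC u≢w =
      compatible-A-edge {B = Fin n} (u≢w ∘ index-injective C≤ u w uC wC ∘ Fin.↑ʳ-injective 1 _ _)
    compatible u w C S uC wS _ rewrite C-complete-to-S u w uC wS = C-vs-S (small-C-cycle-role (position w wS))
    compatible u w C I _  _  _ = tt
    compatible u w S S uS wS u≢w rewrite adj-S uS wS =
      Compatible-map (Fin.↑ˡ-injective (1 + k) _ _) (cycle-injective _ _) _ _
        (small-C-cycle-role-compatible _ _ (position-≢ uS wS u≢w))
    compatible u w S I uS wI _ rewrite Graph.sym G u w | I-anticomplete-to-S w u wI uS =
      S-vs-I wI (small-C-cycle-role (position u uS))
    compatible u w I I uI wI u≢w rewrite I-independent u w uI wI = compatible-B-non-edge {A = Fin (2 + k)} u≢w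
    compatible u w S C uS wC u≢w = swap role u w S C uS wC (compatible w u C S wC uS (u≢w ∘ sym))
    compatible u w I C uI wC u≢w = swap role u w I C uI wC (compatible w u C I wC uI (u≢w ∘ sym))
    compatible u w I S uI wS u≢w = swap role u w I S uI wS (compatible w u S I wS uI (u≢w ∘ sym))

  CI-bound⇒polar : AtMost k IsCI → Polar (2 + k) G
  CI-bound⇒polar CI≤ = roles⇒polar G (λ v → role v (block v) refl) (λ u w → compatible u w _ _ refl refl)
    where
    hub : Fin n
    hub = cycle 2F
    hub≢I : ∀ {x} → block x ≡ I → hub ≢ x
    hub≢I xI = blocks-differ (cycle-in-S 2F) xI λ ()
    C-role : ∀ v → block v ≡ C → Dec (HasINeighbour v) → Fin (2 + k) ⊎ Fin n
    C-role v vC (yes h) = inj₁ (2 ↑ʳ index CI≤ v (vC , h))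
    C-role v vC (no _)  = inj₂ hub
    S-role : Fin 2 ⊎ ⊤ → Fin (2 + k) ⊎ Fin n
    S-role = Sum.map (_↑ˡ k) (const hub)
    role : ∀ v b → block v ≡ b → Fin (2 + k) ⊎ Fin n
    role v C vC = C-role v vC (hasINeighbour? v)
    role v S vS = S-role (small-CI-cycle-role (position v vS))
    role v I _  = inj₂ v
    C-vs-S : ∀ {v} vC (h : Dec (HasINeighbour v)) r → Compatible true (C-role v vC h) (S-role r)
    C-vs-S vC (yes h) (inj₁ b) = compatible-A-edge {B = Fin n} (↑ˡ≢↑ʳ b _ ∘ sym)
    C-vs-S vC (no _)  (inj₂ _) = compatible-B-edge {A = Fin (2 + k)}
    C-vs-S vC (yes h) (inj₂ _) = tt
    C-vs-S vC (no _)  (inj₁ _) = tt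
    S-vs-I : ∀ {x} → block x ≡ I → ∀ r → Compatible false (S-role r) (inj₂ x)
    S-vs-I _  (inj₁ _) = tt
    S-vs-I xI (inj₂ _) = compatible-B-non-edge {A = Fin (2 + k)} (hub≢I xI)
    compatible : ∀ u w bu bw (ub : block u ≡ bu) (wb : block w ≡ bw) → u ≢ w →
                 Compatible (adj G u w) (role u bu ub) (role w bw wb)
    compatible u w C C uC wC u≢w rewrite C-clique u w uC wC u≢w with hasINeighbour? u | hasINeighbour? w
    ... | yes hu | yes hw = compatible-A-edge {B = Fin n}
                              (u≢w ∘ index-injective CI≤ u w (uC , hu) (wC , hw) ∘ Fin.↑ʳ-injective 2 _ _)
    ... | no _   | no _   = compatible-B-edge {A = Fin (2 + k)}
    ... | yes _  | no _   = tt
    ... | no _   | yes _  = tt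
    compatible u w C S uC wS _ rewrite C-complete-to-S u w uC wS =
      C-vs-S uC (hasINeighbour? u) (small-CI-cycle-role (position w wS))
    compatible u w C I uC wI _ with hasINeighbour? u
    ... | yes _ = tt
    ... | no no-I rewrite ¬-not {adj G u w} (λ uw → no-I (w , wI , uw)) =
      compatible-B-non-edge {A = Fin (2 + k)} (hub≢I wI)
    compatible u w S S uS wS u≢w rewrite adj-S uS wS =
      Compatible-map (Fin.↑ˡ-injective k _ _) (λ _ → refl) _ _
        (small-CI-cycle-role-compatible _ _ (position-≢ uS wS u≢w))
    compatible u w S I uS wI _ rewrite Graph.sym G u w | I-anticomplete-to-S w u wI uS =
      S-vs-I wI (small-CI-cycle-role (position u uS))
    compatible u w I I uI wI u≢w rewrite I-independent u w uI wI = compatible-B-non-edge {A = Fin (2 + k)} u≢w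
    compatible u w S C uS wC u≢w = swap role u w S C uS wC (compatible w u C S wC uS (u≢w ∘ sym))
    compatible u w I C uI wC u≢w = swap role u w I C uI wC (compatible w u C I wC uI (u≢w ∘ sym))
    compatible u w I S uI wS u≢w = swap role u w I S uI wS (compatible w u S I wS uI (u≢w ∘ sym))

  bounded⇒polar : CliqueBound k → Polar (2 + k) G
  bounded⇒polar = [ clique-bound⇒polar , CI-bound⇒polar ]′

module _ {G : Graph (1 + n)} (P : PseudoSplitC5 G) where
  open PseudoSplitC5 P

  delete-PseudoSplitC5 : ∀ v → block v ≢ S → PseudoSplitC5 (delete G v)
  delete-PseudoSplitC5 v v∉S = record
    { block               = block ∘ punchIn v
    ; cycle               = λ i → punchOut (v≢cycle i)
    ; cycle-injective     = λ i j → cycle-injective i j ∘ Fin.punchOut-injective (v≢cycle i) (v≢cycle j)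
    ; cycle-in-S          = λ i → subst (λ x → block x ≡ S) (sym (Fin.punchIn-punchOut (v≢cycle i))) (cycle-in-S i)
    ; cycle-onto-S        = λ u uS → position (punchIn v u) uS ,
                              Fin.punchIn-injective v _ _ (trans (Fin.punchIn-punchOut _) (cycle-position _ uS))
    ; cycle-adj           = λ i j →
                              trans (cong₂ (adj G) (Fin.punchIn-punchOut _) (Fin.punchIn-punchOut _)) (cycle-adj i j)
    ; C-clique            = λ u w uC wC u≢w → C-clique _ _ uC wC (u≢w ∘ Fin.punchIn-injective v u w)
    ; I-independent       = λ u w → I-independent _ _
    ; C-complete-to-S     = λ u w → C-complete-to-S _ _
    ; I-anticomplete-to-S = λ u w → I-anticomplete-to-S _ _
    }
    where
    v≢cycle : ∀ i → v ≢ cycle i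
    v≢cycle i v≡cycle = v∉S (trans (cong block v≡cycle) (cycle-in-S i))

  -- G - v is split: A = I ∪ (N(v) ∩ S) is independent and B = C ∪ (S ∖ N[v]) is a clique.
  delete-S⇒polar : ∀ {s} v → block v ≡ S → Polar (1 + s) (delete G v)
  delete-S⇒polar v vS =
    split⇒polar (delete G v) (λ u → inA (punchIn v u) (block (punchIn v u)))
      (λ u w au aw u≢w → independent _ _ _ _ refl refl au aw (u≢w ∘ Fin.punchIn-injective v u w))
      (λ u w bu bw u≢w → clique _ _ _ _ refl refl bu bw (Fin.punchInᵢ≢i v u ∘ sym) (Fin.punchInᵢ≢i v w ∘ sym)
                                (u≢w ∘ Fin.punchIn-injective v u w))
    where
    inA : Fin (1 + n) → Block → Bool
    inA u C = false
    inA u S = adj G v u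
    inA u I = true
    independent : ∀ u w bu bw → block u ≡ bu → block w ≡ bw → inA u bu ≡ true → inA w bw ≡ true → u ≢ w →
                  adj G u w ≡ false
    independent u w I I uI wI _ _ _ = I-independent u w uI wI
    independent u w I S uI wS _ _ _ = I-anticomplete-to-S u w uI wS
    independent u w S I uS wI _ _ _ = trans (Graph.sym G u w) (I-anticomplete-to-S w u wI uS)
    independent u w S S uS wS vu vw u≢w =
      trans (adj-S uS wS) (c5-common-neighbours-nonadjacent _ _ _ (trans (sym (adj-S vS uS)) vu)
                             (trans (sym (adj-S vS wS)) vw) (position-≢ uS wS u≢w))
    clique : ∀ u w bu bw → block u ≡ bu → block w ≡ bw → inA u bu ≡ false → inA w bw ≡ false →
             v ≢ u → v ≢ w → u ≢ w → adj G u w ≡ true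
    clique u w C C uC wC _ _ _ _ u≢w = C-clique u w uC wC u≢w
    clique u w C S uC wS _ _ _ _ _   = C-complete-to-S u w uC wS
    clique u w S C uS wC _ _ _ _ _   = trans (Graph.sym G u w) (C-complete-to-S w u wC uS)
    clique u w S S uS wS vu vw v≢u v≢w u≢w =
      trans (adj-S uS wS) (c5-common-non-neighbours-adjacent _ _ _ (position-≢ vS uS v≢u) (position-≢ vS wS v≢w)
                             (trans (sym (adj-S vS uS)) vu) (trans (sym (adj-S vS wS)) vw) (position-≢ uS wS u≢w))

  module _ (v : Fin (1 + n)) (v∉S : block v ≢ S) where
    open PseudoSplitC5 (delete-PseudoSplitC5 v v∉S) using () renaming (IsCI to IsCI⁻; HasINeighbour to HasINeighbour⁻)

    INeighbour-survives : ∀ u → INeighbourOtherThan v (punchIn v u) → HasINeighbour⁻ u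
    INeighbour-survives u (x , xI , v≢x , ux) =
      punchOut v≢x , subst (λ y → block y ≡ I) (sym (Fin.punchIn-punchOut v≢x)) xI ,
      trans (cong (adj G (punchIn v u)) (Fin.punchIn-punchOut v≢x)) ux

    clique-bound-lifts : block v ≢ C → AtMost k (Is C ∘ punchIn v) → AtMost k (Is C)
    clique-bound-lifts v∉C C⁻≤ =
      AtMost-⊆ (λ u uC → uC , λ { refl → v∉C uC }) (AtMost-unpunch {X = Is C} v C⁻≤)

    CI-bound-lifts : (∀ c → IsCI c → v ≢ c × INeighbourOtherThan v c) → AtMost k IsCI⁻ → AtMost k IsCI
    CI-bound-lifts lifts CI⁻≤ =
      AtMost-⊆ (λ c cCI → cCI , proj₁ (lifts c cCI))
        (AtMost-unpunch {X = IsCI} v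
          (AtMost-⊆ (λ u uCI → proj₁ uCI , INeighbour-survives u (proj₂ (lifts _ uCI))) CI⁻≤))

module MinimalObstruction {k n : ℕ} {G : Graph (1 + n)} (P : PseudoSplitC5 G)
                          (not-polar : ¬ Polar (2 + k) G) (deleted-polar : ∀ v → Polar (2 + k) (delete G v)) where
  open PseudoSplitC5 P

  deleted-bound : ∀ v (v∉S : block v ≢ S) → PseudoSplitC5.CliqueBound (delete-PseudoSplitC5 P v v∉S) k
  deleted-bound v v∉S = polar⇒bounded (delete-PseudoSplitC5 P v v∉S) (deleted-polar v)

  C-bound : AtMost (2 + k) (Is C)
  C-bound with Fin.any? (λ c → (block c ≟ᴮ C) ×-dec ¬? (hasINeighbour? c))
  ... | yes (c , cC , no-I) =
    [ AtMost-insert c ∘ AtMost-unpunch {X = Is C} c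
    , ⊥-elim ∘ not-polar ∘ CI-bound⇒polar P ∘ CI-bound-lifts P c c∉S lifts
    ]′ (deleted-bound c c∉S)
    where
    c∉S : block c ≢ S
    c∉S = other-block cC λ ()
    lifts : ∀ u → IsCI u → c ≢ u × INeighbourOtherThan c u
    lifts u (uC , x , xI , ux) = (λ { refl → no-I (x , xI , ux) }) , x , xI , blocks-differ cC xI (λ ()) , ux
  ... | no every-C-has-I with Fin.any? (λ c → block c ≟ᴮ C)
  ...   | no  no-C       = AtMost-empty λ c cC → no-C (c , cC)
  ...   | yes (c , cC) =
    [ AtMost-insert c ∘ AtMost-unpunch {X = Is C} c
    , AtMost-suc ∘ AtMost-insert c ∘ AtMost-unpunch {X = Is C} c ∘ AtMost-⊆ C⁻⊆CI⁻
    ]′ (deleted-bound c c∉S)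
    where
    c∉S : block c ≢ S
    c∉S = other-block cC λ ()
    C⁻⊆CI⁻ : ∀ u → block (punchIn c u) ≡ C → PseudoSplitC5.IsCI (delete-PseudoSplitC5 P c c∉S) u
    C⁻⊆CI⁻ u uC with decidable-stable (hasINeighbour? (punchIn c u)) (λ no-I → every-C-has-I (_ , uC , no-I))
    ... | x , xI , ux = uC , INeighbour-survives P c c∉S u (x , xI , blocks-differ cC xI (λ ()) , ux)

  PrivateNeighbour : Fin (1 + n) → Fin (1 + n) → Set
  PrivateNeighbour x c = block c ≡ C × adj G c x ≡ true × ¬ INeighbourOtherThan x c

  private-neighbour : ∀ x → block x ≡ I → ∃ (PrivateNeighbour x)
  private-neighbour x xI
    with Fin.any? (λ c → (block c ≟ᴮ C) ×-dec (adj G c x Bool.≟ true) ×-dec ¬? (iNeighbourOtherThan? x c))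
  ... | yes found = found
  ... | no no-private = ⊥-elim $ not-polar $ bounded⇒polar P $
    Sum.map (clique-bound-lifts P x x∉S (other-block xI λ ())) (CI-bound-lifts P x x∉S lifts) (deleted-bound x x∉S)
    where
    x∉S : block x ≢ S
    x∉S = other-block xI λ ()
    lifts : ∀ c → IsCI c → x ≢ c × INeighbourOtherThan x c
    lifts c (cC , y , yI , cy) = blocks-differ xI cC (λ ()) , other (x Fin.≟ y)
      where
      other : Dec (x ≡ y) → INeighbourOtherThan x c
      other (no x≢y)   = y , yI , x≢y , cy
      other (yes refl) = decidable-stable (iNeighbourOtherThan? x c) λ no-other → no-private (c , cC , cy , no-other)

  I-bound : AtMost (1 + k) (Is I)
  I-bound with Fin.any? (λ x → block x ≟ᴮ I)
  ... | no  no-I       = AtMost-empty λ x xI → no-I (x , xI)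
  ... | yes (x₀ , x₀I) =
    [ ⊥-elim ∘ not-polar ∘ clique-bound⇒polar P ∘ clique-bound-lifts P x₀ x₀∉S (other-block x₀I λ ())
    , AtMost-insert x₀ ∘ AtMost-inject private-index private-index-into private-index-injective
    ]′ (deleted-bound x₀ x₀∉S)
    where
    x₀∉S : block x₀ ≢ S
    x₀∉S = other-block x₀I λ ()
    π : ∀ x → block x ≡ I → Fin (1 + n)
    π x xI = proj₁ (private-neighbour x xI)
    πC : ∀ x xI → block (π x xI) ≡ C
    πC x xI = proj₁ (proj₂ (private-neighbour x xI))
    πx : ∀ x xI → adj G (π x xI) x ≡ true
    πx x xI = proj₁ (proj₂ (proj₂ (private-neighbour x xI)))
    x₀≢π : ∀ x xI → x₀ ≢ π x xI
    x₀≢π x xI = blocks-differ x₀I (πC x xI) λ ()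
    private-index : ∀ x → block x ≡ I × x₀ ≢ x → Fin n
    private-index x (xI , _) = punchOut (x₀≢π x xI)
    private-index-into : ∀ x x∈I-x₀ → PseudoSplitC5.IsCI (delete-PseudoSplitC5 P x₀ x₀∉S) (private-index x x∈I-x₀)
    private-index-into x (xI , x₀≢x) =
      subst (λ c → block c ≡ C) (sym (Fin.punchIn-punchOut (x₀≢π x xI))) (πC x xI) ,
      INeighbour-survives P x₀ x₀∉S _
        (x , xI , x₀≢x , trans (cong (λ c → adj G c x) (Fin.punchIn-punchOut (x₀≢π x xI))) (πx x xI))
    private-index-injective : ∀ x y x∈ y∈ → private-index x x∈ ≡ private-index y y∈ → x ≡ y
    private-index-injective x y (xI , _) (yI , _) eq with x Fin.≟ y
    ... | yes x≡y = x≡y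
    ... | no  x≢y = ⊥-elim (proj₂ (proj₂ (proj₂ (private-neighbour y yI))) (x , xI , x≢y ∘ sym ,
                      subst (λ c → adj G c x ≡ true) (Fin.punchOut-injective (x₀≢π x xI) (x₀≢π y yI) eq) (πx x xI)))

  size-bound : 1 + n ≤ (2 + k) + (5 + (1 + k))
  size-bound =
    AtMost⇒≤ (AtMost-⊆ (λ v _ → by-block v (block v) refl) (AtMost-⊎ C-bound (AtMost-⊎ S-bound I-bound)))
    where
    by-block : ∀ v b → block v ≡ b → Is C v ⊎ Is S v ⊎ Is I v
    by-block v C vC = inj₁ vC
    by-block v S vS = inj₂ (inj₁ vS)
    by-block v I vI = inj₂ (inj₂ vI)

vertex-count : ∀ k → (2 + k) + (5 + (1 + k)) ≡ 2 * (2 + k) + 4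
vertex-count = solve-∀

pseudo-split-obstruction-size : ∀ n (G : Graph n) → PseudoSplit G → MinObstruction (2 + k) G → n ≤ 2 * (2 + k) + 4
pseudo-split-obstruction-size ℕ.zero G _ _ = ℕ.z≤n
pseudo-split-obstruction-size {k} (ℕ.suc n) G pseudo-split (not-polar , deleted-polar)
  with PseudoSplit⇒polar⊎C5 {G = G} {s = 1 + k} pseudo-split
... | inj₁ polar = ⊥-elim (not-polar polar)
... | inj₂ P     = subst (1 + n ≤_) (vertex-count k) (MinimalObstruction.size-bound P not-polar deleted-polar)

module TightExample (k : ℕ) where

  data Kind : Set where
    clique-vertex : Fin (2 + k) → Kind
    cycle-vertex  : Fin 5 → Kind
    stable-vertex : Fin (1 + k) → Kind

  N : ℕ
  N = (2 + k) + (5 + (1 + k))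

  kind : Fin N → Kind
  kind v = [ clique-vertex , [ cycle-vertex , stable-vertex ]′ ∘ splitAt 5 ]′ (splitAt (2 + k) v)

  vertex : Kind → Fin N
  vertex (clique-vertex j) = j ↑ˡ (5 + (1 + k))
  vertex (cycle-vertex i)  = (2 + k) ↑ʳ (i ↑ˡ (1 + k))
  vertex (stable-vertex j) = (2 + k) ↑ʳ (5 ↑ʳ j)

  kind-vertex : ∀ κ → kind (vertex κ) ≡ κ
  kind-vertex (clique-vertex j) rewrite Fin.splitAt-↑ˡ (2 + k) j (5 + (1 + k)) = refl
  kind-vertex (cycle-vertex i)  rewrite Fin.splitAt-↑ʳ (2 + k) (5 + (1 + k)) (i ↑ˡ (1 + k))
                                      | Fin.splitAt-↑ˡ 5 i (1 + k) = refl
  kind-vertex (stable-vertex j) rewrite Fin.splitAt-↑ʳ (2 + k) (5 + (1 + k)) (5 ↑ʳ j) = refl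

  vertex-kind : ∀ v → vertex (kind v) ≡ v
  vertex-kind v with splitAt (2 + k) v in eq
  ... | inj₁ j = Fin.splitAt⁻¹-↑ˡ eq
  ... | inj₂ u with splitAt 5 u in eq′
  ...   | inj₁ i = trans (cong ((2 + k) ↑ʳ_) (Fin.splitAt⁻¹-↑ˡ eq′)) (Fin.splitAt⁻¹-↑ʳ eq)
  ...   | inj₂ j = trans (cong ((2 + k) ↑ʳ_) (Fin.splitAt⁻¹-↑ʳ eq′)) (Fin.splitAt⁻¹-↑ʳ eq)

  kind-injective : ∀ {u w} → kind u ≡ kind w → u ≡ w
  kind-injective {u} {w} eq = trans (sym (vertex-kind u)) (trans (cong vertex eq) (vertex-kind w))

  vertex-injective : ∀ {κ κ′} → vertex κ ≡ vertex κ′ → κ ≡ κ′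
  vertex-injective {κ} {κ′} eq = trans (sym (kind-vertex κ)) (trans (cong kind eq) (kind-vertex κ′))

  -- The clique vertex inject₁ j is matched with the stable vertex j; the last clique vertex has no I-neighbour.
  adjᴷ : Kind → Kind → Bool
  adjᴷ (cycle-vertex i)  (cycle-vertex j)  = c5 i j
  adjᴷ (cycle-vertex _)  (clique-vertex _) = true
  adjᴷ (clique-vertex _) (cycle-vertex _)  = true
  adjᴷ (clique-vertex i) (clique-vertex j) = not (does (i Fin.≟ j))
  adjᴷ (clique-vertex i) (stable-vertex j) = does (i Fin.≟ inject₁ j)
  adjᴷ (stable-vertex j) (clique-vertex i) = does (i Fin.≟ inject₁ j)
  adjᴷ _                 _                 = false

  adjᴷ-sym : ∀ κ κ′ → adjᴷ κ κ′ ≡ adjᴷ κ′ κ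
  adjᴷ-sym (cycle-vertex i)  (cycle-vertex j)  = c5-sym i j
  adjᴷ-sym (clique-vertex i) (clique-vertex j) = cong not (does-⇔ (mk⇔ sym sym) (i Fin.≟ j) (j Fin.≟ i))
  adjᴷ-sym (cycle-vertex _)  (clique-vertex _) = refl
  adjᴷ-sym (cycle-vertex _)  (stable-vertex _) = refl
  adjᴷ-sym (clique-vertex _) (cycle-vertex _)  = refl
  adjᴷ-sym (clique-vertex _) (stable-vertex _) = refl
  adjᴷ-sym (stable-vertex _) (cycle-vertex _)  = refl
  adjᴷ-sym (stable-vertex _) (clique-vertex _) = refl
  adjᴷ-sym (stable-vertex _) (stable-vertex _) = refl

  adjᴷ-irrefl : ∀ κ → adjᴷ κ κ ≡ false
  adjᴷ-irrefl (cycle-vertex i)  = c5-irrefl i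
  adjᴷ-irrefl (clique-vertex i) = cong not (dec-true (i Fin.≟ i) refl)
  adjᴷ-irrefl (stable-vertex _) = refl

  G : Graph N
  G = record
    { adj    = λ u w → adjᴷ (kind u) (kind w)
    ; sym    = λ u w → adjᴷ-sym (kind u) (kind w)
    ; irrefl = λ v → adjᴷ-irrefl (kind v)
    }

  blockᴷ : Kind → Block
  blockᴷ (clique-vertex _) = C
  blockᴷ (cycle-vertex _)  = S
  blockᴷ (stable-vertex _) = I

  P : PseudoSplitC5 G
  P = record
    { block               = blockᴷ ∘ kind
    ; cycle               = vertex ∘ cycle-vertex
    ; cycle-injective     = λ i j → cycle-vertex-injective ∘ vertex-injective
    ; cycle-in-S          = λ i → cong blockᴷ (kind-vertex (cycle-vertex i))
    ; cycle-onto-S        = λ v vS → onto-S (kind v) vS (vertex-kind v)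
    ; cycle-adj           = λ i j → cong₂ adjᴷ (kind-vertex (cycle-vertex i)) (kind-vertex (cycle-vertex j))
    ; C-clique            = λ u w uC wC u≢w → C-cliqueᴷ (kind u) (kind w) uC wC (u≢w ∘ kind-injective)
    ; I-independent       = λ u w → I-independentᴷ (kind u) (kind w)
    ; C-complete-to-S     = λ u w → C-complete-to-Sᴷ (kind u) (kind w)
    ; I-anticomplete-to-S = λ u w → I-anticomplete-to-Sᴷ (kind u) (kind w)
    }
    where
    cycle-vertex-injective : ∀ {i j} → cycle-vertex i ≡ cycle-vertex j → i ≡ j
    cycle-vertex-injective refl = refl
    onto-S : ∀ κ {v} → blockᴷ κ ≡ S → vertex κ ≡ v → ∃ λ i → vertex (cycle-vertex i) ≡ v
    onto-S (cycle-vertex i) _ eq = i , eq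
    C-cliqueᴷ : ∀ κ κ′ → blockᴷ κ ≡ C → blockᴷ κ′ ≡ C → κ ≢ κ′ → adjᴷ κ κ′ ≡ true
    C-cliqueᴷ (clique-vertex i) (clique-vertex j) _ _ κ≢κ′ =
      cong not (dec-false (i Fin.≟ j) (κ≢κ′ ∘ cong clique-vertex))
    I-independentᴷ : ∀ κ κ′ → blockᴷ κ ≡ I → blockᴷ κ′ ≡ I → adjᴷ κ κ′ ≡ false
    I-independentᴷ (stable-vertex _) (stable-vertex _) _ _ = refl
    C-complete-to-Sᴷ : ∀ κ κ′ → blockᴷ κ ≡ C → blockᴷ κ′ ≡ S → adjᴷ κ κ′ ≡ true
    C-complete-to-Sᴷ (clique-vertex _) (cycle-vertex _) _ _ = refl
    I-anticomplete-to-Sᴷ : ∀ κ κ′ → blockᴷ κ ≡ I → blockᴷ κ′ ≡ S → adjᴷ κ κ′ ≡ false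
    I-anticomplete-to-Sᴷ (stable-vertex _) (cycle-vertex _) _ _ = refl

  open PseudoSplitC5 P using (block; Is; IsCI; other-block)

  clique-index : Kind → Fin (2 + k)
  clique-index (clique-vertex j) = j
  clique-index _                 = zero

  stable-index : Kind → Fin (1 + k)
  stable-index (stable-vertex j) = j
  stable-index _                 = zero

  clique-index-injective : ∀ κ κ′ → blockᴷ κ ≡ C → blockᴷ κ′ ≡ C → clique-index κ ≡ clique-index κ′ → κ ≡ κ′
  clique-index-injective (clique-vertex _) (clique-vertex _) _ _ = cong clique-vertex

  stable-index-injective : ∀ κ κ′ → blockᴷ κ ≡ I → blockᴷ κ′ ≡ I → stable-index κ ≡ stable-index κ′ → κ ≡ κ′
  stable-index-injective (stable-vertex _) (stable-vertex _) _ _ = cong stable-vertex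

  matched : ∀ κ κ′ → blockᴷ κ ≡ C → blockᴷ κ′ ≡ I → adjᴷ κ κ′ ≡ true →
            clique-index κ ≡ inject₁ (stable-index κ′)
  matched (clique-vertex i) (stable-vertex j) _ _ adjacent with i Fin.≟ inject₁ j
  ... | yes i≡j = i≡j

  partner-adjacent : ∀ κ → blockᴷ κ ≡ I → adjᴷ (clique-vertex (inject₁ (stable-index κ))) κ ≡ true
  partner-adjacent (stable-vertex j) _ = dec-true (inject₁ j Fin.≟ inject₁ j) refl

  clique-bound : AtMost (2 + k) (Is C)
  clique-bound = record
    { index           = λ v _ → clique-index (kind v)
    ; index-injective = λ u w uC wC → kind-injective ∘ clique-index-injective (kind u) (kind w) uC wC
    }

  CI-bound : AtMost (1 + k) IsCI
  CI-bound = record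
    { index           = λ c (_ , x , _) → stable-index (kind x)
    ; index-injective = λ u w (uC , x , xI , ux) (wC , y , yI , wy) eq →
        kind-injective (clique-index-injective (kind u) (kind w) uC wC
          (trans (matched (kind u) (kind x) uC xI ux)
                 (trans (cong inject₁ eq) (sym (matched (kind w) (kind y) wC yI wy)))))
    }

  clique-vertex-injective : ∀ {i j} → clique-vertex i ≡ clique-vertex j → i ≡ j
  clique-vertex-injective refl = refl

  not-polar : ¬ Polar (2 + k) G
  not-polar Q with polar⇒bounded P Q
  ... | inj₁ C≤ = ℕₚ.1+n≰n $
    AtMost-pigeonhole (vertex ∘ clique-vertex) (λ i j → clique-vertex-injective ∘ vertex-injective)
                      (λ j → cong blockᴷ (kind-vertex (clique-vertex j))) C≤
  ... | inj₂ CI≤ = ℕₚ.1+n≰n $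
    AtMost-pigeonhole (vertex ∘ clique-vertex ∘ inject₁)
                      (λ i j → Fin.inject₁-injective ∘ clique-vertex-injective ∘ vertex-injective) matched-vertex CI≤
    where
    matched-vertex : ∀ j → IsCI (vertex (clique-vertex (inject₁ j)))
    matched-vertex j = cong blockᴷ (kind-vertex (clique-vertex (inject₁ j))) , vertex (stable-vertex j) ,
      cong blockᴷ (kind-vertex (stable-vertex j)) ,
      trans (cong₂ adjᴷ (kind-vertex (clique-vertex (inject₁ j))) (kind-vertex (stable-vertex j)))
            (partner-adjacent (stable-vertex j) refl)

  deleted-polar : ∀ v → Polar (2 + k) (delete G v)
  deleted-polar v = by-block (block v) refl
    where
    by-block : ∀ b → block v ≡ b → Polar (2 + k) (delete G v)
    by-block S vS = delete-S⇒polar P v vS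
    by-block C vC = bounded⇒polar (delete-PseudoSplitC5 P v (other-block {v = v} vC λ ())) $ inj₁ $
      AtMost-inject (λ u _ → punchIn v u) (λ u uC → uC , Fin.punchInᵢ≢i v u ∘ sym)
                    (λ u w _ _ → Fin.punchIn-injective v u w)
        (AtMost-remove clique-bound vC)
    -- G - v loses one vertex of C ∩ N(I): the partner of v, whose only I-neighbour is v.
    by-block I vI = bounded⇒polar (delete-PseudoSplitC5 P v v∉S) $ inj₂ $
      AtMost-inject (λ u _ → punchIn v u) survives (λ u w _ _ → Fin.punchIn-injective v u w)
        (AtMost-remove CI-bound partner-CI)
      where
      v∉S : block v ≢ S
      v∉S = other-block {v = v} vI λ ()
      partnerᴷ : Kind
      partnerᴷ = clique-vertex (inject₁ (stable-index (kind v)))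
      partner : Fin N
      partner = vertex partnerᴷ
      partner-CI : IsCI partner
      partner-CI = cong blockᴷ (kind-vertex partnerᴷ) , v , vI ,
                   trans (cong (λ κ → adjᴷ κ (kind v)) (kind-vertex partnerᴷ)) (partner-adjacent (kind v) vI)
      survives : ∀ u → PseudoSplitC5.IsCI (delete-PseudoSplitC5 P v v∉S) u →
                 IsCI (punchIn v u) × partner ≢ punchIn v u
      survives u (uC , x , xI , ux) = (uC , punchIn v x , xI , ux) , λ partner≡u →
        Fin.punchInᵢ≢i v x (sym (kind-injective (stable-index-injective (kind v) (kind (punchIn v x)) vI xI
          (Fin.inject₁-injective (trans (sym (cong clique-index (kind-vertex partnerᴷ)))
            (trans (cong (clique-index ∘ kind) partner≡u) (matched (kind (punchIn v u)) (kind (punchIn v x)) uC xI ux)))))))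

  tight : Σ (Graph N) λ G → PseudoSplit G × MinObstruction (2 + k) G
  tight = G , PseudoSplitC5⇒PseudoSplit P , not-polar , deleted-polar

tight-example : ∀ k → Σ (Graph (2 * (2 + k) + 4)) λ G → PseudoSplit G × MinObstruction (2 + k) G
tight-example k = subst (λ m → Σ (Graph m) λ G → PseudoSplit G × MinObstruction (2 + k) G) (vertex-count k)
                        (TightExample.tight k)

mainTheorem8 : (s : ℕ) → 3 ≤ s →
    ((n : ℕ) (G : Graph n) → PseudoSplit G → MinObstruction s G → n ≤ 2 * s + 4)
    × Σ (Graph (2 * s + 4)) (λ G → PseudoSplit G × MinObstruction s G)
mainTheorem8 (ℕ.suc (ℕ.suc (ℕ.suc j))) (ℕ.s≤s (ℕ.s≤s (ℕ.s≤s ℕ.z≤n))) =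
  pseudo-split-obstruction-size , tight-example (1 + j)
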